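{- Let $\Sigma$ be a finite alphabet, $k\in\mathbb{N}$, and $w,\tilde w\in\Sigma^*$ with $\iota(w)=\iota(\tilde w)=1$, with $\alpha$-$\beta$-factorizations $w=\alpha_0\beta_1\alpha_1$ and $\tilde w=\tilde\alpha_0\tilde\beta_1\tilde\alpha_1$, and suppose $\alpha_0=\alpha_1=\tilde\alpha_0=\tilde\alpha_1=\varepsilon$. Then $w\sim_k\tilde w$ if and only if $k=1$, or $k\geq2$, $\mathrm{m}(w)=\mathrm{m}(\tilde w)$, $\mathrm{rm}(w)=\mathrm{rm}(\tilde w)$, and $\mathrm{core}_1(w)\sim_k\mathrm{core}_1(\tilde w)$.
   Context: A word $u$ is a scattered factor of $w$ if $u$ is obtained from $w$ by deleting some letters (keeping order). For $k\in\mathbb{N}_0$, $u\sim_k v$ iff $u$ and $v$ have exactly the same scattered factors of length at most $k$. $\iota(w)$ is the largest $\ell$ such that every word of $\Sigma^\ell$ is a scattered factor of $w$. The arch factorization of $w$ is the unique factorization $w=\mathrm{ar}_1(w)\cdots\mathrm{ar}_\ell(w)\mathrm{re}(w)$ where each arch contains every letter of $\Sigma$ and its last letter occurs exactly once in it, and $\mathrm{re}(w)$ does not contain every letter of $\Sigma$; $\ell=\iota(w)$. The modus $\mathrm{m}(w)$ is the word of last letters of the arches. With $w^R$ the reversal, $\mathrm{ra}_i(w)\coloneqq(\mathrm{ar}_{\iota(w)-i+1}(w^R))^R$, $\mathrm{er}(w)\coloneqq(\mathrm{re}(w^R))^R$, and the reverse modus $\mathrm{rm}(w)\coloneqq(\mathrm{m}(w^R))^R$.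 When $\iota(w)=1$ the $\alpha$-$\beta$-factorization is $w=\alpha_0\beta_1\alpha_1$ with $\mathrm{ar}_1(w)=\alpha_0\beta_1$, $\mathrm{ra}_1(w)=\beta_1\alpha_1$, $\alpha_0=\mathrm{er}(w)$, $\alpha_1=\mathrm{re}(w)$. $\mathrm{core}_1(w)\coloneqq\varepsilon$ if $|\beta_1|\in\{1,2\}$ and $\beta_1[2..|\beta_1|-1]$ otherwise. -}

module Defs where

open import Data.Nat using (ℕ; zero; suc; _≤_; _<_; _∸_)
open import Data.Fin using (Fin)
open import Data.Fin.Properties using (_≟_)
open import Data.List using (List; []; _∷_; _++_; length; reverse; allFin; concat; concatMap; drop; take)
open import Data.List.Relation.Unary.All using (All; all?)
open import Data.List.Relation.Unary.Any using (any?)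
open import Data.List.Membership.Propositional using (_∈_)
open import Data.List.Relation.Binary.Sublist.Propositional using (_⊆_)
open import Data.Maybe using (Maybe; just; nothing)
open import Data.Product using (_×_; _,_; proj₁; proj₂)
open import Data.Bool using (if_then_else_)
open import Relation.Nullary using (¬_; Dec; does)
open import Relation.Binary.PropositionalEquality using (_≡_)
open import Function.Bundles using (_⇔_)

Word : ℕ → Set
Word σ = List (Fin σ)

_≼_ : ∀ {σ} → Word σ → Word σ → Set
u ≼ w = u ⊆ w

_∼[_]_ : ∀ {σ} → Word σ → ℕ → Word σ → Set
_∼[_]_ {σ} u k v = (x : Word σ) → length x ≤ k → (x ≼ u ⇔ x ≼ v)

Iota : ∀ {σ} → Word σ → ℕ → Set
Iota {σ} w ℓ =
  ((u : Word σ) → length u ≡ ℓ → u ≼ w) ×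
  ((m : ℕ) → ℓ < m → ¬ ((u : Word σ) → length u ≡ m → u ≼ w))

Complete : ∀ {σ} → Word σ → Set
Complete {σ} u = All (λ a → a ∈ u) (allFin σ)

complete? : ∀ {σ} (u : Word σ) → Dec (Complete u)
complete? {σ} u = all? (λ a → any? (λ b → a ≟ b) u) (allFin σ)

-- first arch: shortest prefix containing every letter, and the remainder
mutual
  archGo : ∀ {σ} → Word σ → Word σ → Maybe (Word σ × Word σ)
  archGo p r = if does (complete? p) then just (p , r) else archStep p r

  archStep : ∀ {σ} → Word σ → Word σ → Maybe (Word σ × Word σ)
  archStep p [] = nothing
  archStep p (x ∷ r) = archGo (p ++ x ∷ []) r

firstArch : ∀ {σ} → Word σ → Maybe (Word σ × Word σ)
firstArch w = archGo [] w

archFactF : ∀ {σ} → ℕ → Word σ → List (Word σ) × Word σ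
archFactF zero w = [] , w
archFactF (suc n) w with firstArch w
... | nothing = [] , w
... | just (a , r) = a ∷ proj₁ (archFactF n r) , proj₂ (archFactF n r)

arches : ∀ {σ} → Word σ → List (Word σ)
arches w = proj₁ (archFactF (length w) w)

re : ∀ {σ} → Word σ → Word σ
re w = proj₂ (archFactF (length w) w)

lastL : ∀ {σ} → Word σ → Word σ
lastL [] = []
lastL (x ∷ []) = x ∷ []
lastL (x ∷ y ∷ r) = lastL (y ∷ r)

modus : ∀ {σ} → Word σ → Word σ
modus w = concatMap lastL (arches w)

er : ∀ {σ} → Word σ → Word σ
er w = reverse (re (reverse w))

rmodus : ∀ {σ} → Word σ → Word σ
rmodus w = reverse (modus (reverse w))

-- β₁ in the α-β-factorization w = α₀ β₁ α₁ (for ι(w) = 1):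
-- ar₁(w) = α₀ β₁ with α₀ = er(w)
beta1 : ∀ {σ} → Word σ → Word σ
beta1 w = drop (length (er w)) (concat (arches w))

-- β[2..|β|-1] for |β| ≥ 3, ε otherwise
coreOf : ∀ {σ} → Word σ → Word σ
coreOf [] = []
coreOf (x ∷ []) = []
coreOf (x ∷ y ∷ []) = []
coreOf (x ∷ y ∷ z ∷ r) = take (suc (length r)) (y ∷ z ∷ r)

core1 : ∀ {σ} → Word σ → Word σ
core1 w = coreOf (beta1 w)

-- Since ι(w) = 1 and α₀ = α₁ = ε, the word w is a single arch read in either
-- direction: its last letter occurs only at the end and its first letter only at the start,
-- so w = h c l with h, l ∉ c, m(w) = l, rm(w) = h and core₁(w) = c (or w is a single letter).
-- For k = 1 both words contain every letter. For k ≥ 2 the scattered factors h̃h and ll̃ of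
-- w̃ force h = h̃ and l = l̃, and since h and l do not occur in the cores, the scattered
-- factors of h c l that avoid h and l are exactly those of c; conversely ∼ₖ is a congruence.
module Submission where

open import Defs
open import Data.Nat using (ℕ; zero; suc; _≤_; s≤s; z≤n)
open import Data.Nat.Properties using (≤-trans; +-comm)
open import Data.Fin using (Fin)
open import Data.List using (List; []; _∷_; _++_; length; reverse; concat; concatMap; take; drop)
open import Data.List.Properties
  using (++-assoc; ++-identityʳ; ∷-injective; ∷-injectiveˡ; length-++; length-++-≤ˡ; length-++-≤ʳ;
         length-reverse; reverse-++; reverse-involutive; reverse-injective)
open import Data.List.Relation.Unary.All as All using (All; []; _∷_)
open import Data.List.Relation.Unary.Any using (here; there)
import Data.List.Relation.Unary.Any.Properties as Any
open import Data.List.Membership.Propositional using (_∈_; _∉_)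
open import Data.List.Membership.Propositional.Properties using (∈-allFin; ∈-++⁻; ∈-++⁺ˡ; ∈-++⁺ʳ)
open import Data.List.Relation.Binary.Sublist.Propositional
  using (_⊆_; []; _∷_; _∷ʳ_; minimum; from∈; to∈; ⊆-refl)
open import Data.List.Relation.Binary.Sublist.Propositional.Properties
  using (++⁺; ++⁺ʳ; ∷ˡ⁻; reverse⁻; Any-resp-⊆)
open import Data.Maybe using (just; nothing)
open import Data.Product using (∃; ∃₂; _×_; _,_; proj₁; proj₂)
open import Data.Sum using (_⊎_; inj₁; inj₂; [_,_])
open import Data.Empty using (⊥-elim)
open import Function.Base using (id; _∘_)
open import Function.Bundles using (_⇔_; mk⇔; Equivalence)
open import Relation.Nullary using (¬_; Dec; yes; no)
open import Relation.Nullary.Decidable using (dec-true; dec-false)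
open import Relation.Binary.PropositionalEquality
  using (_≡_; refl; sym; trans; cong; subst; subst₂; module ≡-Reasoning)

private
  variable
    σ k : ℕ

⊆-++-split : ∀ {x : Word σ} a {b} → x ⊆ a ++ b → ∃₂ λ x₁ x₂ → x ≡ x₁ ++ x₂ × x₁ ⊆ a × x₂ ⊆ b
⊆-++-split [] s = [] , _ , refl , [] , s
⊆-++-split (y ∷ a) (.y ∷ʳ s) with ⊆-++-split a s
... | x₁ , x₂ , refl , s₁ , s₂ = x₁ , x₂ , refl , y ∷ʳ s₁ , s₂
⊆-++-split (y ∷ a) (refl ∷ s) with ⊆-++-split a s
... | x₁ , x₂ , refl , s₁ , s₂ = y ∷ x₁ , x₂ , refl , refl ∷ s₁ , s₂

⊆-∷⁻-∉ : ∀ {h : Fin σ} {x w} → h ∉ x → x ⊆ h ∷ w → x ⊆ w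
⊆-∷⁻-∉ h∉x (_ ∷ʳ s) = s
⊆-∷⁻-∉ h∉x (refl ∷ s) = ⊥-elim (h∉x (here refl))

⊆-snoc⁻-∉ : ∀ {l : Fin σ} {x} w → l ∉ x → x ⊆ w ++ l ∷ [] → x ⊆ w
⊆-snoc⁻-∉ [] l∉x (_ ∷ʳ []) = []
⊆-snoc⁻-∉ [] l∉x (refl ∷ s) = ⊥-elim (l∉x (here refl))
⊆-snoc⁻-∉ (z ∷ w) l∉x (.z ∷ʳ s) = z ∷ʳ ⊆-snoc⁻-∉ w l∉x s
⊆-snoc⁻-∉ (z ∷ w) l∉x (refl ∷ s) = refl ∷ ⊆-snoc⁻-∉ w (l∉x ∘ there) s

unique-first-⊆⇒≡ : ∀ {h h′ : Fin σ} {r} → h ∉ r → (h′ ∷ h ∷ []) ⊆ h ∷ r → h′ ≡ h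
unique-first-⊆⇒≡ h∉r (_ ∷ʳ s) = ⊥-elim (h∉r (to∈ (∷ˡ⁻ s)))
unique-first-⊆⇒≡ h∉r (h′≡h ∷ _) = h′≡h

unique-last-⊈ : ∀ {l y : Fin σ} q → l ∉ q → ¬ (l ∷ y ∷ []) ⊆ q ++ l ∷ []
unique-last-⊈ [] l∉q (_ ∷ʳ ())
unique-last-⊈ [] l∉q (refl ∷ ())
unique-last-⊈ (z ∷ q) l∉q (.z ∷ʳ s) = unique-last-⊈ q (l∉q ∘ there) s
unique-last-⊈ (z ∷ q) l∉q (refl ∷ s) = l∉q (here refl)

∼-refl : ∀ (u : Word σ) → u ∼[ k ] u
∼-refl u x _ = mk⇔ id id

∼-sym : ∀ {u v : Word σ} → u ∼[ k ] v → v ∼[ k ] u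
∼-sym u∼v x |x| = mk⇔ (Equivalence.from (u∼v x |x|)) (Equivalence.to (u∼v x |x|))

∼-++ : ∀ {u u′ v v′ : Word σ} → u ∼[ k ] u′ → v ∼[ k ] v′ → (u ++ v) ∼[ k ] (u′ ++ v′)
∼-++ u∼u′ v∼v′ x |x| = mk⇔ (transfer u∼u′ v∼v′) (transfer (∼-sym u∼u′) (∼-sym v∼v′))
  where
  transfer : ∀ {u u′ v v′} → u ∼[ _ ] u′ → v ∼[ _ ] v′ → x ⊆ u ++ v → x ⊆ u′ ++ v′
  transfer {u} u∼u′ v∼v′ s with ⊆-++-split u s
  ... | x₁ , x₂ , refl , s₁ , s₂ =
    ++⁺ (Equivalence.to (u∼u′ x₁ (≤-trans (length-++-≤ˡ x₁) |x|)) s₁)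
        (Equivalence.to (v∼v′ x₂ (≤-trans (length-++-≤ʳ x₂ {x₁}) |x|)) s₂)

complete⇒∈ : ∀ {u : Word σ} → Complete u → ∀ a → a ∈ u
complete⇒∈ c a = All.lookup c (∈-allFin a)

complete⇒∼₁ : ∀ {u v : Word σ} → Complete u → Complete v → u ∼[ 1 ] v
complete⇒∼₁ cu cv [] _ = mk⇔ (λ _ → minimum _) (λ _ → minimum _)
complete⇒∼₁ cu cv (y ∷ []) _ = mk⇔ (λ _ → from∈ (complete⇒∈ cv y)) (λ _ → from∈ (complete⇒∈ cu y))
complete⇒∼₁ cu cv (_ ∷ _ ∷ _) (s≤s ())

complete-pair-⊆ : ∀ {a b : Word σ} → Complete a → Complete b → ∀ y z t → (y ∷ z ∷ []) ⊆ a ++ b ++ t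
complete-pair-⊆ ca cb y z t = ++⁺ (from∈ (complete⇒∈ ca y)) (++⁺ʳ t (from∈ (complete⇒∈ cb z)))

snoc-completes⇒∉ : ∀ {q : Word σ} {x} → ¬ Complete q → Complete (q ++ x ∷ []) → x ∉ q
snoc-completes⇒∉ {q = q} ¬cq c x∈q =
  ¬cq (All.tabulate λ {a} _ → [ id , (λ { (here refl) → x∈q }) ] (∈-++⁻ q (complete⇒∈ c a)))

Arch : Word σ → Set
Arch a = Complete a × ∃₂ λ q x → a ≡ q ++ x ∷ [] × x ∉ q

archGo-complete : ∀ {p : Word σ} r → Complete p → archGo p r ≡ just (p , r)
archGo-complete {p = p} r c rewrite dec-true (complete? p) c = refl

archGo-incomplete : ∀ {p : Word σ} r → ¬ Complete p → archGo p r ≡ archStep p r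
archGo-incomplete {p = p} r ¬c rewrite dec-false (complete? p) ¬c = refl

archGo-sound : ∀ {p : Word σ} r {a r′} → ¬ Complete p → archGo p r ≡ just (a , r′) →
  a ++ r′ ≡ p ++ r × Arch a
archGo-sound [] ¬c eq with trans (sym (archGo-incomplete [] ¬c)) eq
... | ()
archGo-sound {p = p} (y ∷ r) ¬c eq =
  snoc (complete? (p ++ y ∷ [])) (trans (sym (archGo-incomplete (y ∷ r) ¬c)) eq)
  where
  snoc : ∀ {a r′} → Dec (Complete (p ++ y ∷ [])) → archGo (p ++ y ∷ []) r ≡ just (a , r′) →
         a ++ r′ ≡ p ++ y ∷ r × Arch a
  snoc (yes c) eq′ with trans (sym (archGo-complete r c)) eq′
  ... | refl = ++-assoc p (y ∷ []) r , c , p , y , refl , snoc-completes⇒∉ ¬c c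
  snoc (no ¬c′) eq′ with archGo-sound r ¬c′ eq′
  ... | e , arch = trans e (++-assoc p (y ∷ []) r) , arch

archFactF-sound : ¬ Complete {σ} [] → ∀ n (w : Word σ) →
  concat (proj₁ (archFactF n w)) ++ proj₂ (archFactF n w) ≡ w × All Arch (proj₁ (archFactF n w))
archFactF-sound ¬c zero w = refl , []
archFactF-sound ¬c (suc n) w with firstArch w in eq
... | nothing = refl , []
... | just (a , r) with archGo-sound w ¬c eq | archFactF-sound ¬c n r
... | a++r≡w , arch | e , arches = trans (++-assoc a _ _) (trans (cong (a ++_) e) a++r≡w) , arch ∷ arches

ι₁⇒complete : ∀ {w : Word σ} → Iota w 1 → Complete w
ι₁⇒complete ι = All.tabulate λ {a} _ → to∈ (proj₁ ι (a ∷ []) refl)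

ι₁⇒¬complete-[] : ∀ {w : Word σ} → Iota w 1 → ¬ Complete {σ} []
ι₁⇒¬complete-[] ι c =
  proj₂ ι 2 (s≤s (s≤s z≤n)) λ { (y ∷ _) _ → ⊥-elim (Any.¬Any[] (complete⇒∈ c y)) }

Iota-reverse : ∀ {w : Word σ} {ℓ} → Iota w ℓ → Iota (reverse w) ℓ
Iota-reverse {w = w} (all , maximal) =
  (λ u |u| → reverse⁻ (subst (reverse u ⊆_) (sym (reverse-involutive w))
                                           (all (reverse u) (length-reverse′ u |u|)))) ,
  λ m ℓ<m all′ → maximal m ℓ<m λ u |u| → reverse⁻ (all′ (reverse u) (length-reverse′ u |u|))
  where
  length-reverse′ : ∀ {n} (u : Word _) → length u ≡ n → length (reverse u) ≡ n
  length-reverse′ u = trans (length-reverse u)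

arches-sound : ¬ Complete {σ} [] → ∀ (w : Word σ) → concat (arches w) ++ re w ≡ w × All Arch (arches w)
arches-sound ¬c w = archFactF-sound ¬c (length w) w

concat-arches : ∀ {w : Word σ} → Iota w 1 → re w ≡ [] → concat (arches w) ≡ w
concat-arches {w = w} ι re≡[] = begin
  concat (arches w)         ≡⟨ ++-identityʳ _ ⟨
  concat (arches w) ++ []   ≡⟨ cong (concat (arches w) ++_) re≡[] ⟨
  concat (arches w) ++ re w ≡⟨ proj₁ (arches-sound (ι₁⇒¬complete-[] ι) w) ⟩
  w                         ∎
  where open ≡-Reasoning

arches-ι₁ : ∀ {w : Word σ} → Iota w 1 → re w ≡ [] → arches w ≡ w ∷ [] × Arch w
arches-ι₁ {w = w} ι re≡[]
  with arches w | concat-arches ι re≡[] | proj₂ (arches-sound (ι₁⇒¬complete-[] ι) w)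
... | [] | refl | _ = ⊥-elim (ι₁⇒¬complete-[] ι (ι₁⇒complete ι))
... | a ∷ [] | a++[]≡w | arch ∷ [] = cong (_∷ []) a≡w , subst Arch a≡w arch
  where a≡w = trans (sym (++-identityʳ a)) a++[]≡w
... | a ∷ b ∷ as | refl | (ca , _) ∷ (cb , _) ∷ _ =
  ⊥-elim (proj₂ ι 2 (s≤s (s≤s z≤n)) λ { (y ∷ z ∷ []) refl → complete-pair-⊆ ca cb y z _ })

take-length-++ : ∀ {A : Set} (xs ys : List A) → take (length xs) (xs ++ ys) ≡ xs
take-length-++ [] ys = refl
take-length-++ (x ∷ xs) ys = cong (x ∷_) (take-length-++ xs ys)

lastL-snoc : ∀ (q : Word σ) x → lastL (q ++ x ∷ []) ≡ x ∷ []
lastL-snoc [] x = refl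
lastL-snoc (y ∷ []) x = refl
lastL-snoc (y ∷ z ∷ q) x = lastL-snoc (z ∷ q) x

coreOf-bracket : ∀ (h : Fin σ) c l → coreOf (h ∷ c ++ l ∷ []) ≡ c
coreOf-bracket h [] l = refl
coreOf-bracket h (y ∷ []) l = refl
coreOf-bracket h (y ∷ z ∷ c) l = begin
  take (suc (length (c ++ l ∷ []))) (y ∷ z ∷ c ++ l ∷ [])
    ≡⟨ cong (λ n → take (suc n) (y ∷ z ∷ c ++ l ∷ [])) (trans (length-++ c) (+-comm (length c) 1)) ⟩
  take (length (y ∷ z ∷ c)) ((y ∷ z ∷ c) ++ l ∷ [])
    ≡⟨ take-length-++ (y ∷ z ∷ c) (l ∷ []) ⟩
  y ∷ z ∷ c ∎
  where open ≡-Reasoning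

last-once : ∀ {w : Word σ} → Iota w 1 → re w ≡ [] →
  ∃₂ λ q l → w ≡ q ++ l ∷ [] × l ∉ q × modus w ≡ l ∷ []
last-once ι re≡[] with arches-ι₁ ι re≡[]
... | arches≡ , _ , q , l , refl , l∉q =
  q , l , refl , l∉q , trans (cong (concatMap lastL) arches≡) (trans (++-identityʳ _) (lastL-snoc q l))

first-once : ∀ {w : Word σ} → Iota w 1 → er w ≡ [] →
  ∃₂ λ h r → w ≡ h ∷ r × h ∉ r × rmodus w ≡ h ∷ []
first-once {w = w} ι er≡[] with last-once (Iota-reverse ι) (reverse-injective {y = []} er≡[])
... | q , h , wʳ≡ , h∉q , m≡ = h , reverse q , w≡ , h∉q ∘ Any.reverse⁻ , cong reverse m≡
  where
  open ≡-Reasoning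
  w≡ : w ≡ h ∷ reverse q
  w≡ = begin
    w                       ≡⟨ reverse-involutive w ⟨
    reverse (reverse w)     ≡⟨ cong reverse wʳ≡ ⟩
    reverse (q ++ h ∷ [])   ≡⟨ reverse-++ q (h ∷ []) ⟩
    h ∷ reverse q           ∎

core1-ι₁ : ∀ {w : Word σ} → Iota w 1 → er w ≡ [] → re w ≡ [] → core1 w ≡ coreOf w
core1-ι₁ {w = w} ι er≡[] re≡[] =
  cong coreOf (trans (cong (λ e → drop (length e) (concat (arches w))) er≡[]) (concat-arches ι re≡[]))

record Bracket (w : Word σ) : Set where
  constructor bracket
  field
    first   : Fin σ
    middle  : Word σ
    last    : Fin σ
    shape   : w ≡ first ∷ middle ++ last ∷ []
    first∉  : first ∉ middle ++ last ∷ []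
    last∉   : last ∉ first ∷ middle
    modus≡  : modus w ≡ last ∷ []
    rmodus≡ : rmodus w ≡ first ∷ []
    core1≡  : core1 w ≡ middle

LetterOrBracket : Word σ → Set
LetterOrBracket w = (∃ λ a → w ≡ a ∷ []) ⊎ Bracket w

ι₁-shape : ∀ {w : Word σ} → Iota w 1 → er w ≡ [] → re w ≡ [] → LetterOrBracket w
ι₁-shape ι er≡[] re≡[] with last-once ι re≡[] | first-once ι er≡[]
... | [] , l , w≡ , _ | _ = inj₁ (l , w≡)
... | _ ∷ c , l , refl , l∉ , m≡ | h , r , w≡ , h∉r , rm≡ with ∷-injective w≡
... | refl , refl =
  inj₂ (bracket h c l refl h∉r l∉ m≡ rm≡ (trans (core1-ι₁ ι er≡[] re≡[]) (coreOf-bracket h c l)))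

complete-[a]⇒≡[a] : ∀ {a : Fin σ} {w} → Complete (a ∷ []) → LetterOrBracket w → w ≡ a ∷ []
complete-[a]⇒≡[a] ca (inj₁ (b , refl)) with complete⇒∈ ca b
... | here refl = refl
complete-[a]⇒≡[a] ca (inj₂ (bracket h c l refl h∉ _ _ _ _)) with complete⇒∈ ca h | complete⇒∈ ca l
... | here refl | here refl = ⊥-elim (h∉ (∈-++⁺ʳ c (here refl)))

head-≡ : ∀ {h h′ : Fin σ} {r r′} → 2 ≤ k → h ∉ r → h ∈ h′ ∷ r′ → (h ∷ r) ∼[ k ] (h′ ∷ r′) → h ≡ h′
head-≡ k≥2 h∉r (here h≡h′) _ = h≡h′
head-≡ k≥2 h∉r (there h∈r′) w∼w̃ =
  sym (unique-first-⊆⇒≡ h∉r (Equivalence.from (w∼w̃ (_ ∷ _ ∷ []) k≥2) (refl ∷ from∈ h∈r′)))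

last-≡ : ∀ {l l′ : Fin σ} → 2 ≤ k → ∀ q q′ → l ∉ q → l ∈ q′ ++ l′ ∷ [] →
  (q ++ l ∷ []) ∼[ k ] (q′ ++ l′ ∷ []) → l ≡ l′
last-≡ k≥2 q q′ l∉q l∈ w∼w̃ with ∈-++⁻ q′ l∈
... | inj₂ (here l≡l′) = l≡l′
... | inj₁ l∈q′ =
  ⊥-elim (unique-last-⊈ q l∉q (Equivalence.from (w∼w̃ (_ ∷ _ ∷ []) k≥2) (++⁺ (from∈ l∈q′) ⊆-refl)))

∼-strip-bracket : ∀ {h l : Fin σ} {c c′} → h ∉ c → l ∉ c → h ∉ c′ → l ∉ c′ →
  (h ∷ c ++ l ∷ []) ∼[ k ] (h ∷ c′ ++ l ∷ []) → c ∼[ k ] c′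
∼-strip-bracket {h = h} {l} h∉c l∉c h∉c′ l∉c′ w∼w̃ x |x| =
  mk⇔ (restrict h∉c l∉c (Equivalence.to (w∼w̃ x |x|)))
      (restrict h∉c′ l∉c′ (Equivalence.from (w∼w̃ x |x|)))
  where
  restrict : ∀ {c c′} → h ∉ c → l ∉ c → (x ⊆ h ∷ c ++ l ∷ [] → x ⊆ h ∷ c′ ++ l ∷ []) → x ⊆ c → x ⊆ c′
  restrict {c′ = c′} h∉c l∉c transfer s =
    ⊆-snoc⁻-∉ c′ (l∉c ∘ Any-resp-⊆ s) (⊆-∷⁻-∉ (h∉c ∘ Any-resp-⊆ s) (transfer (h ∷ʳ ++⁺ʳ (l ∷ []) s)))

CoreCriterion : ℕ → Word σ → Word σ → Set
CoreCriterion k w w̃ =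
  k ≡ 1 ⊎ (2 ≤ k × modus w ≡ modus w̃ × rmodus w ≡ rmodus w̃ × core1 w ∼[ k ] core1 w̃)

∼⇔criterion-refl : 1 ≤ k → (w : Word σ) → (w ∼[ k ] w ⇔ CoreCriterion k w w)
∼⇔criterion-refl {k = suc zero} _ w = mk⇔ (λ _ → inj₁ refl) (λ _ → ∼-refl w)
∼⇔criterion-refl {k = suc (suc _)} _ w =
  mk⇔ (λ _ → inj₂ (s≤s (s≤s z≤n) , refl , refl , ∼-refl (core1 w))) (λ _ → ∼-refl w)

bracket-∼⇒criterion : ∀ {w w̃ : Word σ} → 1 ≤ k → Bracket w → Bracket w̃ → Complete w̃ →
  w ∼[ k ] w̃ → CoreCriterion k w w̃
bracket-∼⇒criterion {k = suc zero} _ _ _ _ _ = inj₁ refl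
bracket-∼⇒criterion {k = suc (suc _)} _ (bracket h c l refl h∉ l∉ m≡ rm≡ core≡)
  (bracket h̃ c̃ l̃ refl h̃∉ l̃∉ m̃≡ rm̃≡ corẽ≡) cw̃ w∼w̃
  with head-≡ (s≤s (s≤s z≤n)) h∉ (complete⇒∈ cw̃ h) w∼w̃
     | last-≡ (s≤s (s≤s z≤n)) (h ∷ c) (h̃ ∷ c̃) l∉ (complete⇒∈ cw̃ l) w∼w̃
... | refl | refl = inj₂ (s≤s (s≤s z≤n) , trans m≡ (sym m̃≡) , trans rm≡ (sym rm̃≡) ,
  subst₂ (λ u v → u ∼[ _ ] v) (sym core≡) (sym corẽ≡)
    (∼-strip-bracket (h∉ ∘ ∈-++⁺ˡ) (l∉ ∘ there) (h̃∉ ∘ ∈-++⁺ˡ) (l̃∉ ∘ there) w∼w̃))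

criterion⇒bracket-∼ : ∀ {w w̃ : Word σ} → Bracket w → Bracket w̃ → Complete w → Complete w̃ →
  CoreCriterion k w w̃ → w ∼[ k ] w̃
criterion⇒bracket-∼ _ _ cw cw̃ (inj₁ refl) = complete⇒∼₁ cw cw̃
criterion⇒bracket-∼ (bracket h c l refl _ _ m≡ rm≡ core≡) (bracket h̃ c̃ l̃ refl _ _ m̃≡ rm̃≡ corẽ≡) _ _
  (inj₂ (_ , modus≡ , rmodus≡ , cores∼))
  with ∷-injectiveˡ (trans (sym m≡) (trans modus≡ m̃≡))
     | ∷-injectiveˡ (trans (sym rm≡) (trans rmodus≡ rm̃≡))
... | refl | refl =
  ∼-++ (∼-refl (h ∷ [])) (∼-++ (subst₂ (λ u v → u ∼[ _ ] v) core≡ corẽ≡ cores∼) (∼-refl (l ∷ [])))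

proposition2 : {σ : ℕ} (k : ℕ) → 1 ≤ k → (w w̃ : Word σ) →
    Iota w 1 → Iota w̃ 1 →
    er w ≡ [] → re w ≡ [] → er w̃ ≡ [] → re w̃ ≡ [] →
    (w ∼[ k ] w̃ ⇔
      (k ≡ 1 ⊎ (2 ≤ k × modus w ≡ modus w̃ × rmodus w ≡ rmodus w̃ × core1 w ∼[ k ] core1 w̃)))
proposition2 k k≥1 w w̃ ι ι̃ er≡[] re≡[] ẽr≡[] r̃e≡[]
  with ι₁-shape ι er≡[] re≡[] | ι₁-shape ι̃ ẽr≡[] r̃e≡[]
... | inj₁ (a , refl) | shapẽ rewrite complete-[a]⇒≡[a] (ι₁⇒complete ι) shapẽ = ∼⇔criterion-refl k≥1 w
... | inj₂ B | inj₁ (ã , refl) rewrite complete-[a]⇒≡[a] (ι₁⇒complete ι̃) (inj₂ B) = ∼⇔criterion-refl k≥1 w̃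
... | inj₂ B | inj₂ B̃ =
  mk⇔ (bracket-∼⇒criterion k≥1 B B̃ (ι₁⇒complete ι̃))
      (criterion⇒bracket-∼ B B̃ (ι₁⇒complete ι) (ι₁⇒complete ι̃))
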